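{- Let $\delta\in(0,1)$. Then there exist $c_1,c_2>0$ such that the following holds. Let $G$ be a graph on $n$ vertices of average degree $d$, and let $X\subseteq V(G)$ be such that every vertex in $X$ has degree at least $(1+\delta)d$. Then $$\mathrm{disc}^{+}(G)\geq c_1\big(e(X)+e(X,X^c)\big)-c_2 n.$$
   Context: For a graph $G$ with $n$ vertices and $m$ edges, its density is $p=m/\binom{n}{2}$ and average degree $d=2m/n$. For $U\subseteq V(G)$, $e(U)$ is the number of edges of $G[U]$, $U^c=V(G)\setminus U$, and for disjoint $U,W$, $e(U,W)$ is the number of edges between $U$ and $W$. Further $\mathrm{disc}(U)=e(U)-p\binom{|U|}{2}$ and $\mathrm{disc}^{+}(G)=\max_{U\subseteq V(G)}\mathrm{disc}(U)$. -}

module Defs where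

open import Data.Bool using (Bool; true; false; if_then_else_; _∧_; not)
open import Data.Nat using (ℕ; zero; suc; _<ᵇ_)
import Data.Nat as ℕ
open import Data.Nat.Combinatorics using (_C_)
open import Data.Fin using (Fin; toℕ)
open import Data.List using (List; []; _∷_; map; allFin; foldr)
open import Data.Nat.ListAction using (sum)
open import Data.Vec using (Vec; []; _∷_; lookup)
import Data.Vec as Vec
open import Data.Integer using (+_)
open import Data.Rational using (ℚ; _/_; _*_; _-_; _⊔_; _+_)
open import Relation.Binary.PropositionalEquality using (_≡_)

record Graph (n : ℕ) : Set where
  field
    adj    : Fin n → Fin n → Bool
    sym    : ∀ i j → adj i j ≡ adj j i
    irrefl : ∀ i → adj i i ≡ false
open Graph public

-- Vertex subsets: as in Data.Fin.Subset, a Vec Bool n (true = inside).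
VSet : ℕ → Set
VSet n = Vec Bool n

complement : ∀ {n} → VSet n → VSet n
complement = Vec.map not

count : ∀ {n} → (Fin n → Bool) → ℕ
count {n} f = sum (map (λ i → if f i then 1 else 0) (allFin n))

countPairs : ∀ {n} → (Fin n → Fin n → Bool) → ℕ
countPairs {n} f = sum (map (λ i → count (λ j → (toℕ i <ᵇ toℕ j) ∧ f i j)) (allFin n))

size : ∀ {n} → VSet n → ℕ
size U = count (lookup U)

edges : ∀ {n} → Graph n → ℕ
edges G = countPairs (adj G)

eIn : ∀ {n} → Graph n → VSet n → ℕ
eIn G U = countPairs (λ i j → lookup U i ∧ lookup U j ∧ adj G i j)

eBetween : ∀ {n} → Graph n → VSet n → VSet n → ℕ
eBetween {n} G U W = sum (map (λ i → count (λ j → lookup U i ∧ lookup W j ∧ adj G i j)) (allFin n))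

degree : ∀ {n} → Graph n → Fin n → ℕ
degree G v = count (adj G v)

-- a / b as a rational, with the convention a / 0 = 0 (only relevant
-- for degenerate graphs with n < 2, which have no edges anyway)
ratio : ℕ → ℕ → ℚ
ratio a zero    = + 0 / 1
ratio a (suc b) = + a / suc b

fromℕ : ℕ → ℚ
fromℕ k = + k / 1

density : ∀ {n} → Graph n → ℚ
density {n} G = ratio (edges G) (n C 2)

avgDegree : ∀ {n} → Graph n → ℚ
avgDegree {n} G = ratio (2 ℕ.* edges G) n

disc : ∀ {n} → Graph n → VSet n → ℚ
disc G U = fromℕ (eIn G U) - density G * fromℕ (size U C 2)

allSubsets : (n : ℕ) → List (VSet n)
allSubsets zero    = [] ∷ []
allSubsets (suc n) = map (true ∷_) (allSubsets n) Data.List.++ map (false ∷_) (allSubsets n)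

-- disc⁺(G) = max over all U of disc(U)  (the list is nonempty; the base
-- value is disc(∅) = 0 which is itself attained)
discPlus : ∀ {n} → Graph n → ℚ
discPlus {n} G = foldr (λ U r → disc G U ⊔ r) (disc G (Vec.replicate n false)) (allSubsets n)

-- For U ⊆ V with indicator vector 𝟙_U, disc(U) is the value at 𝟙_U of the quadratic form
-- Q(x) = Σ_{i<j} x_i x_j (a_ij − p).  Q is affine in each coordinate, so rounding the
-- coordinates of any point of [0,1]ⁿ one at a time towards the larger value reaches a
-- vertex 𝟙_U with disc(U) ≥ Q(x).  Take x_i = ½ + t·1_X(i) with t = δ/2.  Using 2m = p n(n−1)
-- and d = p(n−1),  2Q(x) = t·vol(X) + 2t²·e(X) − t·d|X| − t²·p|X|(|X|−1),  where
-- vol(X) = Σ_{v∈X} deg v = 2e(X) + e(X,Xᶜ).  The degree condition gives vol(X) ≥ (1+δ)·d|X|,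
-- so the linear term beats both losses and Q(x) ≥ (δ²/16)(e(X) + e(X,Xᶜ)); any c₂ > 0 works.

module Submission where

open import Defs
open import Data.Nat using (ℕ) renaming (_+_ to _+ℕ_)
open import Data.Nat using (zero; suc; _<ᵇ_)
open import Data.Fin using (Fin)
open import Data.Vec using (lookup)
open import Data.Bool using (true)
open import Data.Product using (Σ; _×_)
open import Data.Rational using (ℚ; 0ℚ; 1ℚ; _<_; _≤_; _+_; _-_; _*_)
open import Relation.Binary.PropositionalEquality using (_≡_)

open import Algebra.Bundles using (CommutativeRing)
import Algebra.Properties.Semiring.Sum
import Data.Nat as ℕ
import Data.Nat.Properties as ℕ
open import Data.Nat.Combinatorics using (_C_; nC1≡n; nCk+nC[k+1]≡[n+1]C[k+1])
import Data.Nat.ListAction as ℕ using (sum)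
open import Data.Fin using (zero; suc; toℕ; _≟_)
open import Data.Bool using (Bool; false; not; _∧_; if_then_else_)
open import Data.Vec using (Vec; []; _∷_; _[_]≔_)
import Data.Vec as Vec
open import Data.Vec.Properties using (lookup∘update; lookup∘update′; lookup-map; lookup∘tabulate)
import Data.List as List
open import Data.List using (_∷_)
import Data.List.Properties as List using (map-tabulate)
open import Data.List.Membership.Propositional using (_∈_)
open import Data.List.Relation.Unary.Any using (here; there)
import Data.List.Relation.Unary.Any as Any using (map)
import Data.List.Relation.Unary.Any.Properties as Any using (++⁺ˡ; ++⁺ʳ; map⁺)
import Data.Integer as ℤ
import Data.Integer.Properties as ℤ
open import Data.Nat.Coprimality using (1-coprimeTo) renaming (sym to coprime-sym)
open import Data.Rational using (-_; ½; _/_; _⊔_; mkℚ; positive; nonNegative; *≤*)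
import Data.Rational.Unnormalised as ℚᵘ
import Data.Rational.Unnormalised.Properties as ℚᵘ
open import Data.Rational.Properties hiding (_≟_)
import Data.Rational.Properties as ℚ using (_≟_)
open import Data.Product using (_,_; ∃; proj₁; proj₂)
open import Data.Sum using (inj₁; inj₂)
open import Function using (_∘_; id)
open import Level using (0ℓ)
open import Relation.Nullary using (does; yes; no)
open import Relation.Nullary.Decidable using (dec⇒maybe)
open import Relation.Binary.PropositionalEquality using (refl; trans; cong; cong₂; subst; subst₂; module ≡-Reasoning)
import Relation.Binary.PropositionalEquality as ≡
open import Tactic.RingSolver using (solve-∀)
open import Data.Nat.Tactic.RingSolver using () renaming (solve-∀ to ℕ-solve-∀)
import Tactic.RingSolver.Core.AlmostCommutativeRing as ACR

ℚ-ring : ACR.AlmostCommutativeRing 0ℓ 0ℓ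
ℚ-ring = ACR.fromCommutativeRing +-*-commutativeRing (λ x → dec⇒maybe (0ℚ ℚ.≟ x))

fromℕ≡mkℚ : ∀ k → fromℕ k ≡ mkℚ (ℤ.+ k) 0 (coprime-sym (1-coprimeTo k))
fromℕ≡mkℚ k = normalize-coprime (coprime-sym (1-coprimeTo k))

fromℕ-+ : ∀ a b → fromℕ (a +ℕ b) ≡ fromℕ a + fromℕ b
fromℕ-+ a b rewrite fromℕ≡mkℚ a | fromℕ≡mkℚ b =
  /-cong (trans (ℤ.pos-+ a b) (≡.sym (cong₂ ℤ._+_ (ℤ.*-identityʳ (ℤ.+ a)) (ℤ.*-identityʳ (ℤ.+ b))))) refl

fromℕ-* : ∀ a b → fromℕ (a ℕ.* b) ≡ fromℕ a * fromℕ b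
fromℕ-* a b rewrite fromℕ≡mkℚ a | fromℕ≡mkℚ b = /-cong (ℤ.pos-* a b) refl

fromℕ-mono-≤ : ∀ {a b} → a ℕ.≤ b → fromℕ a ≤ fromℕ b
fromℕ-mono-≤ {a} {b} a≤b rewrite fromℕ≡mkℚ a | fromℕ≡mkℚ b =
  *≤* (subst₂ ℤ._≤_ (≡.sym (ℤ.*-identityʳ (ℤ.+ a))) (≡.sym (ℤ.*-identityʳ (ℤ.+ b))) (ℤ.+≤+ a≤b))

fromℕ-nonNeg : ∀ a → 0ℚ ≤ fromℕ a
fromℕ-nonNeg a = fromℕ-mono-≤ (ℕ.z≤n {a})

ratio-*-suc : ∀ a b → ratio a (suc b) * fromℕ (suc b) ≡ fromℕ a
ratio-*-suc a b = toℚᵘ-injective (ℚᵘ.≃-trans (toℚᵘ-homo-* (ratio a (suc b)) (fromℕ (suc b)))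
  (ℚᵘ.≃-trans (ℚᵘ.*-cong (toℚᵘ-fromℚᵘ (ℚᵘ.mkℚᵘ (ℤ.+ a) b))
                         (toℚᵘ-fromℚᵘ (ℚᵘ.mkℚᵘ (ℤ.+ suc b) 0)))
  (ℚᵘ.≃-trans (ℚᵘ.*≡* cross-multiplied) (ℚᵘ.≃-sym (toℚᵘ-fromℚᵘ (ℚᵘ.mkℚᵘ (ℤ.+ a) 0))))))
  where
  cross-multiplied : (ℤ.+ a ℤ.* ℤ.+ suc b) ℤ.* ℤ.+ 1 ≡ ℤ.+ a ℤ.* ℤ.+ suc (b ℕ.* 1)
  cross-multiplied rewrite ℕ.*-identityʳ b = ℤ.*-identityʳ _

-- The hypothesis matters only for c = 0, where ratio returns the junk value 0.
ratio-* : ∀ a c → fromℕ a ≤ fromℕ c → ratio a c * fromℕ c ≡ fromℕ a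
ratio-* a zero    a≤0 = ≤-antisym (fromℕ-nonNeg a) a≤0
ratio-* a (suc b) _   = ratio-*-suc a b

ratio-nonNeg : ∀ a c → 0ℚ ≤ ratio a c
ratio-nonNeg a zero    = ≤-refl
ratio-nonNeg a (suc b) = nonNegative⁻¹ _ {{normalize-nonNeg a (suc b)}}

*-cancelʳ-fromℕ-suc : ∀ {x y} n → x * fromℕ (suc n) ≡ y * fromℕ (suc n) → x ≡ y
*-cancelʳ-fromℕ-suc n xN≡yN =
  ≤-antisym (*-cancelʳ-≤-pos (fromℕ (suc n)) (≤-reflexive xN≡yN))
            (*-cancelʳ-≤-pos (fromℕ (suc n)) (≤-reflexive (≡.sym xN≡yN)))
  where instance _ = normalize-pos (suc n) 1

0≤q-p⇒p≤q : ∀ {a b} → 0ℚ ≤ b - a → a ≤ b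
0≤q-p⇒p≤q {a} {b} 0≤b-a = subst₂ _≤_ (+-identityˡ a) (q-p+p≡q a b) (+-monoˡ-≤ a 0≤b-a)
  where
  q-p+p≡q : ∀ a b → b - a + a ≡ b
  q-p+p≡q = solve-∀ ℚ-ring

p≤q⇒0≤q-p : ∀ {a b} → a ≤ b → 0ℚ ≤ b - a
p≤q⇒0≤q-p {a} {b} a≤b = subst (_≤ b - a) (+-inverseʳ a) (+-monoˡ-≤ (- a) a≤b)

*-nonNeg : ∀ {a b} → 0ℚ ≤ a → 0ℚ ≤ b → 0ℚ ≤ a * b
*-nonNeg {a} {b} 0≤a 0≤b =
  nonNegative⁻¹ (a * b) {{nonNeg*nonNeg⇒nonNeg a {{nonNegative 0≤a}} b {{nonNegative 0≤b}}}}

p-q≤p : ∀ a {c} → 0ℚ ≤ c → a - c ≤ a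
p-q≤p a {c} 0≤c = 0≤q-p⇒p≤q (subst (0ℚ ≤_) (gap a c) 0≤c)
  where
  gap : ∀ a c → c ≡ a - (a - c)
  gap = solve-∀ ℚ-ring

+-nonNeg : ∀ {a b} → 0ℚ ≤ a → 0ℚ ≤ b → 0ℚ ≤ a + b
+-nonNeg = +-mono-≤

𝟙 : Bool → ℚ
𝟙 true  = 1ℚ
𝟙 false = 0ℚ

𝟙-∧ : ∀ a b → 𝟙 (a ∧ b) ≡ 𝟙 a * 𝟙 b
𝟙-∧ true  b = ≡.sym (*-identityˡ (𝟙 b))
𝟙-∧ false b = ≡.sym (*-zeroˡ (𝟙 b))

𝟙-idem : ∀ b → 𝟙 b * 𝟙 b ≡ 𝟙 b
𝟙-idem true  = refl
𝟙-idem false = refl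

0≤𝟙 : ∀ b → 0ℚ ≤ 𝟙 b
0≤𝟙 true  = fromℕ-nonNeg 1
0≤𝟙 false = ≤-refl

𝟙≤1 : ∀ b → 𝟙 b ≤ 1ℚ
𝟙≤1 true  = ≤-refl
𝟙≤1 false = fromℕ-nonNeg 1

open module ℚ-Sum = Algebra.Properties.Semiring.Sum (CommutativeRing.semiring +-*-commutativeRing)
  using (sum-syntax; ∑-distrib-+; ∑-comm; sum-cong-≗; *-distribˡ-sum)

∑-scale : ∀ {n} c (f : Fin n → ℚ) → ∑[ i < n ] (c * f i) ≡ c * ∑[ i < n ] f i
∑-scale c f = ≡.sym (*-distribˡ-sum c f)

∑-const : ∀ n c → ∑[ i < n ] c ≡ c * fromℕ n
∑-const zero    c = ≡.sym (*-zeroʳ c)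
∑-const (suc n) c = begin
  c + ∑[ i < n ] c       ≡⟨ cong₂ _+_ (≡.sym (*-identityʳ c)) (∑-const n c) ⟩
  c * 1ℚ + c * fromℕ n   ≡⟨ *-distribˡ-+ c 1ℚ (fromℕ n) ⟨
  c * (1ℚ + fromℕ n)     ≡⟨ cong (c *_) (≡.sym (fromℕ-+ 1 n)) ⟩
  c * fromℕ (suc n)      ∎
  where open ≡-Reasoning

∑-mono-≤ : ∀ {n} {f g : Fin n → ℚ} → (∀ i → f i ≤ g i) → ∑[ i < n ] f i ≤ ∑[ i < n ] g i
∑-mono-≤ {zero}  f≤g = ≤-refl
∑-mono-≤ {suc n} f≤g = +-mono-≤ (f≤g zero) (∑-mono-≤ (f≤g ∘ suc))

∑-delta : ∀ {n} (i : Fin n) (g : Fin n → ℚ) → ∑[ j < n ] (𝟙 (does (i ≟ j)) * g j) ≡ g i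
∑-delta {suc n} zero g = begin
  1ℚ * g zero + ∑[ j < n ] (0ℚ * g (suc j)) ≡⟨ cong₂ _+_ (*-identityˡ (g zero)) (sum-cong-≗ (*-zeroˡ ∘ g ∘ suc)) ⟩
  g zero + ∑[ j < n ] 0ℚ                    ≡⟨ cong (g zero +_) (trans (∑-const n 0ℚ) (*-zeroˡ (fromℕ n))) ⟩
  g zero + 0ℚ                               ≡⟨ +-identityʳ (g zero) ⟩
  g zero                                    ∎
  where open ≡-Reasoning
∑-delta (suc i) g = trans (cong₂ _+_ (*-zeroˡ (g zero)) (∑-delta i (g ∘ suc))) (+-identityˡ (g (suc i)))

∑∑ : ∀ {n} → (Fin n → Fin n → ℚ) → ℚ
∑∑ {n} h = ∑[ i < n ] ∑[ j < n ] h i j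

∑∑-cong : ∀ {n} {h k : Fin n → Fin n → ℚ} → (∀ i j → h i j ≡ k i j) → ∑∑ h ≡ ∑∑ k
∑∑-cong h≡k = sum-cong-≗ (λ i → sum-cong-≗ (h≡k i))

∑∑-distrib-+ : ∀ {n} (h k : Fin n → Fin n → ℚ) → ∑∑ (λ i j → h i j + k i j) ≡ ∑∑ h + ∑∑ k
∑∑-distrib-+ {n} h k =
  trans (sum-cong-≗ (λ i → ∑-distrib-+ (h i) (k i))) (∑-distrib-+ (λ i → ∑[ j < n ] h i j) (λ i → ∑[ j < n ] k i j))

∑∑-scale : ∀ {n} c (h : Fin n → Fin n → ℚ) → ∑∑ (λ i j → c * h i j) ≡ c * ∑∑ h
∑∑-scale {n} c h = trans (sum-cong-≗ (λ i → ∑-scale c (h i))) (∑-scale c (λ i → ∑[ j < n ] h i j))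

∑∑-+-scale : ∀ {n} c (h k : Fin n → Fin n → ℚ) → ∑∑ (λ i j → c * h i j + k i j) ≡ c * ∑∑ h + ∑∑ k
∑∑-+-scale c h k = trans (∑∑-distrib-+ (λ i j → c * h i j) k) (cong (_+ ∑∑ k) (∑∑-scale c h))

∑∑-sub-scale : ∀ {n} c (h k : Fin n → Fin n → ℚ) → ∑∑ (λ i j → h i j - c * k i j) ≡ ∑∑ h - c * ∑∑ k
∑∑-sub-scale c h k = begin
  ∑∑ (λ i j → h i j - c * k i j)       ≡⟨ ∑∑-cong (λ i j → cong (h i j +_) (neg-distribˡ-* c (k i j))) ⟩
  ∑∑ (λ i j → h i j + - c * k i j)     ≡⟨ ∑∑-distrib-+ h (λ i j → - c * k i j) ⟩
  ∑∑ h + ∑∑ (λ i j → - c * k i j)      ≡⟨ cong (∑∑ h +_) (∑∑-scale (- c) k) ⟩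
  ∑∑ h + - c * ∑∑ k                    ≡⟨ cong (∑∑ h +_) (neg-distribˡ-* c (∑∑ k)) ⟨
  ∑∑ h - c * ∑∑ k                      ∎
  where open ≡-Reasoning

∑∑-transpose : ∀ {n} (h : Fin n → Fin n → ℚ) → ∑∑ (λ i j → h j i) ≡ ∑∑ h
∑∑-transpose h = ∑-comm (λ i j → h j i)

∑∑-product : ∀ {n} (u w : Fin n → ℚ) → ∑∑ (λ i j → u i * w j) ≡ ∑[ i < _ ] u i * ∑[ j < _ ] w j
∑∑-product {n} u w = begin
  ∑[ i < n ] ∑[ j < n ] (u i * w j) ≡⟨ sum-cong-≗ (λ i → ∑-scale (u i) w) ⟩
  ∑[ i < n ] (u i * ∑[ j < n ] w j) ≡⟨ sum-cong-≗ (λ i → *-comm (u i) (∑[ j < n ] w j)) ⟩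
  ∑[ i < n ] (∑[ j < n ] w j * u i) ≡⟨ ∑-scale (∑[ j < n ] w j) u ⟩
  ∑[ j < n ] w j * ∑[ i < n ] u i   ≡⟨ *-comm (∑[ j < n ] w j) (∑[ i < n ] u i) ⟩
  ∑[ i < n ] u i * ∑[ j < n ] w j   ∎
  where open ≡-Reasoning

𝟙< : ∀ {n} → Fin n → Fin n → ℚ
𝟙< i j = 𝟙 (toℕ i <ᵇ toℕ j)

∑< : ∀ {n} → (Fin n → Fin n → ℚ) → ℚ
∑< h = ∑∑ (λ i j → 𝟙< i j * h i j)

𝟙<-trichotomy : ∀ {n} (i j : Fin n) → 𝟙< i j + 𝟙< j i + 𝟙 (does (i ≟ j)) ≡ 1ℚ
𝟙<-trichotomy zero    zero    = refl
𝟙<-trichotomy zero    (suc j) = refl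
𝟙<-trichotomy (suc i) zero    = refl
𝟙<-trichotomy (suc i) (suc j) = 𝟙<-trichotomy i j

𝟙<-irrefl : ∀ {n} (i : Fin n) → 𝟙< i i ≡ 0ℚ
𝟙<-irrefl i = cong 𝟙 (n<ᵇn (toℕ i))
  where
  n<ᵇn : ∀ n → (n <ᵇ n) ≡ false
  n<ᵇn zero    = refl
  n<ᵇn (suc n) = n<ᵇn n

∑∑-split-diagonal : ∀ {n} (h : Fin n → Fin n → ℚ) →
  ∑∑ h ≡ ∑< h + ∑< (λ i j → h j i) + ∑[ i < n ] h i i
∑∑-split-diagonal {n} h = begin
  ∑∑ h
    ≡⟨ ∑∑-cong (λ i j → ≡.sym (trans (cong (_* h i j) (𝟙<-trichotomy i j)) (*-identityˡ (h i j)))) ⟩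
  ∑∑ (λ i j → (𝟙< i j + 𝟙< j i + δ i j) * h i j)
    ≡⟨ ∑∑-cong (λ i j → distrib₃ (𝟙< i j) (𝟙< j i) (δ i j) (h i j)) ⟩
  ∑∑ (λ i j → 𝟙< i j * h i j + 𝟙< j i * h i j + δ i j * h i j)
    ≡⟨ ∑∑-distrib-+ _ (λ i j → δ i j * h i j) ⟩
  ∑∑ (λ i j → 𝟙< i j * h i j + 𝟙< j i * h i j) + ∑∑ (λ i j → δ i j * h i j)
    ≡⟨ cong₂ _+_ (∑∑-distrib-+ (λ i j → 𝟙< i j * h i j) (λ i j → 𝟙< j i * h i j))
                 (sum-cong-≗ (λ i → ∑-delta i (h i))) ⟩
  ∑< h + ∑∑ (λ i j → 𝟙< j i * h i j) + ∑[ i < n ] h i i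
    ≡⟨ cong (λ s → ∑< h + s + ∑[ i < n ] h i i) (∑∑-transpose (λ i j → 𝟙< j i * h i j)) ⟨
  ∑< h + ∑< (λ i j → h j i) + ∑[ i < n ] h i i ∎
  where
  open ≡-Reasoning
  δ : Fin n → Fin n → ℚ
  δ i j = 𝟙 (does (i ≟ j))
  distrib₃ : ∀ a b c x → (a + b + c) * x ≡ a * x + b * x + c * x
  distrib₃ = solve-∀ ℚ-ring

∑∑-hollow-symmetric : ∀ {n} (h : Fin n → Fin n → ℚ) → (∀ i j → h i j ≡ h j i) → (∀ i → h i i ≡ 0ℚ) →
  ∑∑ h ≡ ∑< h + ∑< h
∑∑-hollow-symmetric {n} h h-sym h-hollow = begin
  ∑∑ h                                            ≡⟨ ∑∑-split-diagonal h ⟩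
  ∑< h + ∑< (λ i j → h j i) + ∑[ i < n ] h i i    ≡⟨ cong₂ (λ s d → ∑< h + s + d)
                                                       (∑∑-cong (λ i j → cong (𝟙< i j *_) (h-sym j i)))
                                                       (trans (sum-cong-≗ h-hollow) (trans (∑-const n 0ℚ) (*-zeroˡ (fromℕ n)))) ⟩
  ∑< h + ∑< h + 0ℚ                                ≡⟨ +-identityʳ (∑< h + ∑< h) ⟩
  ∑< h + ∑< h                                     ∎
  where open ≡-Reasoning

∑<-symmetric : ∀ {n} (h : Fin n → Fin n → ℚ) → (∀ i j → h i j ≡ h j i) →
  ∑< h ≡ ½ * (∑∑ h - ∑[ i < n ] h i i)
∑<-symmetric {n} h h-sym = begin
  ∑< h                                             ≡⟨ halve (∑< h) (∑[ i < n ] h i i) ⟩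
  ½ * (∑< h + ∑< h + ∑[ i < n ] h i i - ∑[ i < n ] h i i)
    ≡⟨ cong (λ s → ½ * (∑< h + s + ∑[ i < n ] h i i - ∑[ i < n ] h i i))
            (∑∑-cong (λ i j → cong (𝟙< i j *_) (h-sym j i))) ⟨
  ½ * (∑< h + ∑< (λ i j → h j i) + ∑[ i < n ] h i i - ∑[ i < n ] h i i)
    ≡⟨ cong (λ s → ½ * (s - ∑[ i < n ] h i i)) (∑∑-split-diagonal h) ⟨
  ½ * (∑∑ h - ∑[ i < n ] h i i)                     ∎
  where
  open ≡-Reasoning
  halve : ∀ x d → x ≡ ½ * (x + x + d - d)
  halve = solve-∀ ℚ-ring

∑<-indicators : ∀ {n} (b : Fin n → Bool) →
  ∑< (λ i j → 𝟙 (b i) * 𝟙 (b j)) ≡ ½ * (∑[ i < n ] 𝟙 (b i) * ∑[ i < n ] 𝟙 (b i) - ∑[ i < n ] 𝟙 (b i))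
∑<-indicators {n} b = begin
  ∑< (λ i j → u i * u j)                         ≡⟨ ∑<-symmetric (λ i j → u i * u j) (λ i j → *-comm (u i) (u j)) ⟩
  ½ * (∑∑ (λ i j → u i * u j) - ∑[ i < n ] (u i * u i))
    ≡⟨ cong₂ (λ s t → ½ * (s - t)) (∑∑-product u u) (sum-cong-≗ (𝟙-idem ∘ b)) ⟩
  ½ * (∑[ i < n ] u i * ∑[ i < n ] u i - ∑[ i < n ] u i) ∎
  where
  open ≡-Reasoning
  u : Fin n → ℚ
  u i = 𝟙 (b i)

fromℕ-∑ : ∀ {n} (h : Fin n → ℕ) → fromℕ (ℕ.sum (List.map h (List.allFin n))) ≡ ∑[ i < n ] fromℕ (h i)
fromℕ-∑ {n} h = trans (cong (fromℕ ∘ ℕ.sum) (List.map-tabulate id h)) (fromℕ-∑-tabulate h)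
  where
  fromℕ-∑-tabulate : ∀ {n} (h : Fin n → ℕ) → fromℕ (ℕ.sum (List.tabulate h)) ≡ ∑[ i < n ] fromℕ (h i)
  fromℕ-∑-tabulate {zero}  h = refl
  fromℕ-∑-tabulate {suc n} h =
    trans (fromℕ-+ (h zero) _) (cong (fromℕ (h zero) +_) (fromℕ-∑-tabulate (h ∘ suc)))

fromℕ-if : ∀ b → fromℕ (if b then 1 else 0) ≡ 𝟙 b
fromℕ-if true  = refl
fromℕ-if false = refl

count≡∑ : ∀ {n} (f : Fin n → Bool) → fromℕ (count f) ≡ ∑[ i < n ] 𝟙 (f i)
count≡∑ f = trans (fromℕ-∑ (λ i → if f i then 1 else 0)) (sum-cong-≗ (fromℕ-if ∘ f))

countPairs≡∑< : ∀ {n} (f : Fin n → Fin n → Bool) → fromℕ (countPairs f) ≡ ∑< (λ i j → 𝟙 (f i j))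
countPairs≡∑< f = trans (fromℕ-∑ (λ i → count (λ j → (toℕ i <ᵇ toℕ j) ∧ f i j)))
  (sum-cong-≗ (λ i → trans (count≡∑ (λ j → (toℕ i <ᵇ toℕ j) ∧ f i j))
                           (sum-cong-≗ (λ j → 𝟙-∧ (toℕ i <ᵇ toℕ j) (f i j)))))

2*[nC2]+n≡n*n : ∀ n → 2 ℕ.* (n C 2) +ℕ n ≡ n ℕ.* n
2*[nC2]+n≡n*n zero    = refl
2*[nC2]+n≡n*n (suc n) = begin
  2 ℕ.* (suc n C 2) +ℕ suc n                 ≡⟨ cong (λ c → 2 ℕ.* c +ℕ suc n) (nCk+nC[k+1]≡[n+1]C[k+1] n 1) ⟨
  2 ℕ.* (n C 1 +ℕ n C 2) +ℕ suc n            ≡⟨ cong (λ c → 2 ℕ.* (c +ℕ n C 2) +ℕ suc n) (nC1≡n n) ⟩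
  2 ℕ.* (n +ℕ n C 2) +ℕ suc n                ≡⟨ regroup n (n C 2) ⟩
  (2 ℕ.* (n C 2) +ℕ n) +ℕ (2 ℕ.* n +ℕ 1)     ≡⟨ cong (_+ℕ (2 ℕ.* n +ℕ 1)) (2*[nC2]+n≡n*n n) ⟩
  n ℕ.* n +ℕ (2 ℕ.* n +ℕ 1)                  ≡⟨ square-suc n ⟩
  suc n ℕ.* suc n                            ∎
  where
  open ≡-Reasoning
  regroup : ∀ n c → 2 ℕ.* (n +ℕ c) +ℕ suc n ≡ (2 ℕ.* c +ℕ n) +ℕ (2 ℕ.* n +ℕ 1)
  regroup = ℕ-solve-∀
  square-suc : ∀ n → n ℕ.* n +ℕ (2 ℕ.* n +ℕ 1) ≡ suc n ℕ.* suc n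
  square-suc = ℕ-solve-∀

fromℕ[nC2] : ∀ n → fromℕ (n C 2) ≡ ½ * (fromℕ n * fromℕ n - fromℕ n)
fromℕ[nC2] n = begin
  fromℕ (n C 2)                           ≡⟨ halve (fromℕ (n C 2)) (fromℕ n) ⟩
  ½ * (fromℕ 2 * fromℕ (n C 2) + fromℕ n - fromℕ n)
    ≡⟨ cong (λ s → ½ * (s - fromℕ n)) (trans (fromℕ-+ (2 ℕ.* (n C 2)) n) (cong (_+ fromℕ n) (fromℕ-* 2 (n C 2)))) ⟨
  ½ * (fromℕ (2 ℕ.* (n C 2) +ℕ n) - fromℕ n) ≡⟨ cong (λ s → ½ * (fromℕ s - fromℕ n)) (2*[nC2]+n≡n*n n) ⟩
  ½ * (fromℕ (n ℕ.* n) - fromℕ n)           ≡⟨ cong (λ s → ½ * (s - fromℕ n)) (fromℕ-* n n) ⟩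
  ½ * (fromℕ n * fromℕ n - fromℕ n)         ∎
  where
  open ≡-Reasoning
  halve : ∀ c k → c ≡ ½ * (fromℕ 2 * c + k - k)
  halve = solve-∀ ℚ-ring

-- Points are vectors so that x [ zero ]≔ a and a ∷ tail x agree definitionally, which lets
-- multiaffine-rounding recurse on the first coordinate without function extensionality.
AffineAt : ∀ {n} → Fin n → (Vec ℚ n → ℚ) → Set
AffineAt v g = ∀ x → g x ≡ g (x [ v ]≔ 0ℚ) + lookup x v * (g (x [ v ]≔ 1ℚ) - g (x [ v ]≔ 0ℚ))

Multiaffine : ∀ {n} → (Vec ℚ n → ℚ) → Set
Multiaffine g = ∀ v → AffineAt v g

InUnitCube : ∀ {n} → Vec ℚ n → Set
InUnitCube x = ∀ i → 0ℚ ≤ lookup x i × lookup x i ≤ 1ℚ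

lerp-≤-⊔ : ∀ a b {c} → 0ℚ ≤ c → c ≤ 1ℚ → a + c * (b - a) ≤ a ⊔ b
lerp-≤-⊔ a b {c} 0≤c c≤1 = 0≤q-p⇒p≤q (subst (0ℚ ≤_) (gap a b c (a ⊔ b))
  (+-nonNeg (*-nonNeg (p≤q⇒0≤q-p c≤1) (p≤q⇒0≤q-p (p≤p⊔q a b))) (*-nonNeg 0≤c (p≤q⇒0≤q-p (p≤q⊔p a b)))))
  where
  gap : ∀ a b c m → (1ℚ - c) * (m - a) + c * (m - b) ≡ m - (a + c * (b - a))
  gap = solve-∀ ℚ-ring

⊔-attained-on-bits : (f : ℚ → ℚ) → ∃ λ b → f 0ℚ ⊔ f 1ℚ ≡ f (𝟙 b)
⊔-attained-on-bits f with ≤-total (f 0ℚ) (f 1ℚ)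
... | inj₁ f0≤f1 = true , p≤q⇒p⊔q≡q f0≤f1
... | inj₂ f1≤f0 = false , p≥q⇒p⊔q≡p f1≤f0

multiaffine-rounding : ∀ {n} (g : Vec ℚ n → ℚ) → Multiaffine g → (x : Vec ℚ n) → InUnitCube x →
  ∃ λ (U : VSet n) → g x ≤ g (Vec.map 𝟙 U)
multiaffine-rounding g g-aff [] _ = [] , ≤-refl
multiaffine-rounding g g-aff (c ∷ x) x∈cube with ⊔-attained-on-bits (λ a → g (a ∷ x))
... | b , g-max with multiaffine-rounding (λ y → g (𝟙 b ∷ y)) (λ v y → g-aff (suc v) (𝟙 b ∷ y)) x (x∈cube ∘ suc)
... | U , gb-x≤gb-U = b ∷ U , (begin
  g (c ∷ x)                                    ≡⟨ g-aff zero (c ∷ x) ⟩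
  g (0ℚ ∷ x) + c * (g (1ℚ ∷ x) - g (0ℚ ∷ x))
    ≤⟨ lerp-≤-⊔ (g (0ℚ ∷ x)) (g (1ℚ ∷ x)) (proj₁ (x∈cube zero)) (proj₂ (x∈cube zero)) ⟩
  g (0ℚ ∷ x) ⊔ g (1ℚ ∷ x)                      ≡⟨ g-max ⟩
  g (𝟙 b ∷ x)                                  ≤⟨ gb-x≤gb-U ⟩
  g (𝟙 b ∷ Vec.map 𝟙 U)                        ∎)
  where open ≤-Reasoning

AffineAt-∑ : ∀ {n m} (v : Fin n) (T : Fin m → Vec ℚ n → ℚ) → (∀ i → AffineAt v (T i)) →
  AffineAt v (λ x → ∑[ i < m ] T i x)
AffineAt-∑ {m = zero}  v T _ x = trivial (lookup x v)
  where
  trivial : ∀ c → 0ℚ ≡ 0ℚ + c * (0ℚ - 0ℚ)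
  trivial = solve-∀ ℚ-ring
AffineAt-∑ {m = suc m} v T T-aff x =
  trans (cong₂ _+_ (T-aff zero x) (AffineAt-∑ v (T ∘ suc) (T-aff ∘ suc) x))
        (lerp-+ (T zero x₀) (T zero x₁) (∑[ i < m ] T (suc i) x₀) (∑[ i < m ] T (suc i) x₁) (lookup x v))
  where
  x₀ x₁ : Vec ℚ _
  x₀ = x [ v ]≔ 0ℚ
  x₁ = x [ v ]≔ 1ℚ
  lerp-+ : ∀ a₀ a₁ b₀ b₁ c →
    (a₀ + c * (a₁ - a₀)) + (b₀ + c * (b₁ - b₀)) ≡ (a₀ + b₀) + c * ((a₁ + b₁) - (a₀ + b₀))
  lerp-+ = solve-∀ ℚ-ring

quadForm : ∀ {n} → (Fin n → Fin n → ℚ) → (Fin n → ℚ) → ℚ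
quadForm w x = ∑< (λ i j → x i * x j * w i j)

-- A term x_i x_j is affine in x_v unless i = j = v; then the factor 𝟙< i i = 0 kills it.
pairTerm-affine : ∀ {n} (v i j : Fin n) (w : ℚ) → AffineAt v (λ x → 𝟙< i j * (lookup x i * lookup x j * w))
pairTerm-affine v i j w x with i ≟ v | j ≟ v
... | yes refl | yes refl rewrite 𝟙<-irrefl i | lookup∘update i x 0ℚ | lookup∘update i x 1ℚ =
  vanishing (lookup x i * lookup x i * w) (0ℚ * 0ℚ * w) (1ℚ * 1ℚ * w) (lookup x i)
  where
  vanishing : ∀ a b c y → 0ℚ * a ≡ 0ℚ * b + y * (0ℚ * c - 0ℚ * b)
  vanishing = solve-∀ ℚ-ring
... | yes refl | no j≢v
  rewrite lookup∘update i x 0ℚ | lookup∘update i x 1ℚ | lookup∘update′ j≢v x 0ℚ | lookup∘update′ j≢v x 1ℚ =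
  linear (𝟙< i j) (lookup x i) (lookup x j) w
  where
  linear : ∀ L c y w → L * (c * y * w) ≡ L * (0ℚ * y * w) + c * (L * (1ℚ * y * w) - L * (0ℚ * y * w))
  linear = solve-∀ ℚ-ring
... | no i≢v | yes refl
  rewrite lookup∘update j x 0ℚ | lookup∘update j x 1ℚ | lookup∘update′ i≢v x 0ℚ | lookup∘update′ i≢v x 1ℚ =
  linear (𝟙< i j) (lookup x j) (lookup x i) w
  where
  linear : ∀ L c y w → L * (y * c * w) ≡ L * (y * 0ℚ * w) + c * (L * (y * 1ℚ * w) - L * (y * 0ℚ * w))
  linear = solve-∀ ℚ-ring
... | no i≢v | no j≢v
  rewrite lookup∘update′ i≢v x 0ℚ | lookup∘update′ i≢v x 1ℚ
        | lookup∘update′ j≢v x 0ℚ | lookup∘update′ j≢v x 1ℚ =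
  constant (𝟙< i j * (lookup x i * lookup x j * w)) (lookup x v)
  where
  constant : ∀ t c → t ≡ t + c * (t - t)
  constant = solve-∀ ℚ-ring

quadForm-multiaffine : ∀ {n} (w : Fin n → Fin n → ℚ) → Multiaffine (quadForm w ∘ lookup)
quadForm-multiaffine w v =
  AffineAt-∑ v _ (λ i → AffineAt-∑ v _ (λ j → pairTerm-affine v i j (w i j)))

quadForm-symmetric : ∀ {n} (w : Fin n → Fin n → ℚ) (x : Fin n → ℚ) → (∀ i j → w i j ≡ w j i) →
  quadForm w x ≡ ½ * (∑∑ (λ i j → x i * x j * w i j) - ∑[ i < n ] (x i * x i * w i i))
quadForm-symmetric w x w-sym =
  ∑<-symmetric (λ i j → x i * x j * w i j) (λ i j → cong₂ _*_ (*-comm (x i) (x j)) (w-sym i j))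

quadForm-cong : ∀ {n} (w : Fin n → Fin n → ℚ) {x y : Fin n → ℚ} → (∀ i → x i ≡ y i) → quadForm w x ≡ quadForm w y
quadForm-cong w x≡y = ∑∑-cong (λ i j → cong (𝟙< i j *_) (cong₂ (λ a b → a * b * w i j) (x≡y i) (x≡y j)))

Adj : ∀ {n} → Graph n → Fin n → Fin n → ℚ
Adj G i j = 𝟙 (adj G i j)

χ : ∀ {n} → VSet n → Fin n → ℚ
χ U i = 𝟙 (lookup U i)

Adj-sym : ∀ {n} (G : Graph n) i j → Adj G i j ≡ Adj G j i
Adj-sym G i j = cong 𝟙 (Graph.sym G i j)

Adj-irrefl : ∀ {n} (G : Graph n) i → Adj G i i ≡ 0ℚ
Adj-irrefl G i = cong 𝟙 (irrefl G i)

size≡∑ : ∀ {n} (U : VSet n) → fromℕ (size U) ≡ ∑[ i < n ] χ U i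
size≡∑ U = count≡∑ (lookup U)

degree≡∑ : ∀ {n} (G : Graph n) v → fromℕ (degree G v) ≡ ∑[ j < n ] Adj G v j
degree≡∑ G v = count≡∑ (adj G v)

edges≡∑< : ∀ {n} (G : Graph n) → fromℕ (edges G) ≡ ∑< (Adj G)
edges≡∑< G = countPairs≡∑< (adj G)

eIn≡∑< : ∀ {n} (G : Graph n) (U : VSet n) → fromℕ (eIn G U) ≡ ∑< (λ i j → χ U i * χ U j * Adj G i j)
eIn≡∑< G U =
  trans (countPairs≡∑< (λ i j → lookup U i ∧ lookup U j ∧ adj G i j)) (∑∑-cong (λ i j → cong (𝟙< i j *_) (begin
  𝟙 (lookup U i ∧ lookup U j ∧ adj G i j)   ≡⟨ 𝟙-∧ (lookup U i) (lookup U j ∧ adj G i j) ⟩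
  χ U i * 𝟙 (lookup U j ∧ adj G i j)         ≡⟨ cong (χ U i *_) (𝟙-∧ (lookup U j) (adj G i j)) ⟩
  χ U i * (χ U j * Adj G i j)                ≡⟨ *-assoc (χ U i) (χ U j) (Adj G i j) ⟨
  χ U i * χ U j * Adj G i j                  ∎)))
  where open ≡-Reasoning

eBetween≡∑∑ : ∀ {n} (G : Graph n) (U W : VSet n) → fromℕ (eBetween G U W) ≡ ∑∑ (λ i j → χ U i * (χ W j * Adj G i j))
eBetween≡∑∑ G U W =
  trans (fromℕ-∑ (λ i → count (λ j → lookup U i ∧ lookup W j ∧ adj G i j)))
  (sum-cong-≗ (λ i → trans (count≡∑ (λ j → lookup U i ∧ lookup W j ∧ adj G i j)) (sum-cong-≗ (λ j →
  trans (𝟙-∧ (lookup U i) (lookup W j ∧ adj G i j)) (cong (χ U i *_) (𝟙-∧ (lookup W j) (adj G i j)))))))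

size-C2≡∑< : ∀ {n} (U : VSet n) → fromℕ (size U C 2) ≡ ∑< (λ i j → χ U i * χ U j)
size-C2≡∑< {n} U = begin
  fromℕ (size U C 2)                               ≡⟨ fromℕ[nC2] (size U) ⟩
  ½ * (fromℕ (size U) * fromℕ (size U) - fromℕ (size U))
    ≡⟨ cong (λ k → ½ * (k * k - k)) (size≡∑ U) ⟩
  ½ * (∑[ i < n ] χ U i * ∑[ i < n ] χ U i - ∑[ i < n ] χ U i) ≡⟨ ∑<-indicators (lookup U) ⟨
  ∑< (λ i j → χ U i * χ U j)                       ∎
  where open ≡-Reasoning

discWeight : ∀ {n} → Graph n → Fin n → Fin n → ℚ
discWeight G i j = Adj G i j - density G

disc≡quadForm : ∀ {n} (G : Graph n) (U : VSet n) → disc G U ≡ quadForm (discWeight G) (χ U)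
disc≡quadForm G U = begin
  fromℕ (eIn G U) - p * fromℕ (size U C 2)
    ≡⟨ cong₂ (λ e c → e - p * c) (eIn≡∑< G U) (size-C2≡∑< U) ⟩
  ∑< (λ i j → χ U i * χ U j * Adj G i j) - p * ∑< (λ i j → χ U i * χ U j)
    ≡⟨ ∑∑-sub-scale p (λ i j → 𝟙< i j * (χ U i * χ U j * Adj G i j)) (λ i j → 𝟙< i j * (χ U i * χ U j)) ⟨
  ∑∑ (λ i j → 𝟙< i j * (χ U i * χ U j * Adj G i j) - p * (𝟙< i j * (χ U i * χ U j)))
    ≡⟨ ∑∑-cong (λ i j → factor (𝟙< i j) (χ U i * χ U j) (Adj G i j) p) ⟩
  quadForm (discWeight G) (χ U) ∎
  where
  open ≡-Reasoning
  p : ℚ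
  p = density G
  factor : ∀ l u a p → l * (u * a) - p * (l * u) ≡ l * (u * (a - p))
  factor = solve-∀ ℚ-ring

disc≤discPlus : ∀ {n} (G : Graph n) (U : VSet n) → disc G U ≤ discPlus G
disc≤discPlus {n} G U = ≤-foldr-⊔ (allSubsets n) (allSubsets-complete U)
  where
  ≤-foldr-⊔ : ∀ Us {U} → U ∈ Us → disc G U ≤ List.foldr (λ W r → disc G W ⊔ r) (disc G (Vec.replicate n false)) Us
  ≤-foldr-⊔ (W ∷ Ws) (here refl) = p≤p⊔q (disc G W) _
  ≤-foldr-⊔ (W ∷ Ws) (there U∈Ws) = ≤-trans (≤-foldr-⊔ Ws U∈Ws) (p≤q⊔p (disc G W) _)
  allSubsets-complete : ∀ {n} (U : VSet n) → U ∈ allSubsets n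
  allSubsets-complete [] = here refl
  allSubsets-complete {suc n} (true ∷ U) =
    Any.++⁺ˡ (Any.map⁺ (Any.map (cong (true ∷_)) (allSubsets-complete U)))
  allSubsets-complete {suc n} (false ∷ U) =
    Any.++⁺ʳ (List.map (true ∷_) (allSubsets n)) (Any.map⁺ (Any.map (cong (false ∷_)) (allSubsets-complete U)))

edges≤nC2 : ∀ {n} (G : Graph n) → fromℕ (edges G) ≤ fromℕ (n C 2)
edges≤nC2 {n} G = begin
  fromℕ (edges G)                                      ≡⟨ edges≡∑< G ⟩
  ∑< (Adj G)
    ≤⟨ ∑-mono-≤ (λ i → ∑-mono-≤ (λ j →
         *-monoˡ-≤-nonNeg (𝟙< i j) {{nonNegative (0≤𝟙 (toℕ i <ᵇ toℕ j))}} (𝟙≤1 (adj G i j)))) ⟩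
  ∑< {n} (λ i j → 1ℚ)                                  ≡⟨ ∑∑-cong {n} (λ i j → cong (𝟙< i j *_) (*-identityˡ 1ℚ)) ⟨
  ∑< {n} (λ i j → 𝟙 true * 𝟙 true)                      ≡⟨ ∑<-indicators {n} (λ _ → true) ⟩
  ½ * (∑[ i < n ] 1ℚ * ∑[ i < n ] 1ℚ - ∑[ i < n ] 1ℚ)
    ≡⟨ cong (λ N → ½ * (N * N - N)) (trans (∑-const n 1ℚ) (*-identityˡ (fromℕ n))) ⟩
  ½ * (fromℕ n * fromℕ n - fromℕ n)                    ≡⟨ fromℕ[nC2] n ⟨
  fromℕ (n C 2)                                        ∎
  where open ≤-Reasoning

twice-edges≡density*[n²-n] : ∀ {n} (G : Graph n) →
  fromℕ (edges G) + fromℕ (edges G) ≡ density G * (fromℕ n * fromℕ n - fromℕ n)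
twice-edges≡density*[n²-n] {n} G = begin
  m + m                                  ≡⟨ cong₂ _+_ m≡pP m≡pP ⟩
  p * P + p * P                          ≡⟨ cong (λ c → p * c + p * c) (fromℕ[nC2] n) ⟩
  p * (½ * (N * N - N)) + p * (½ * (N * N - N)) ≡⟨ double-half p (N * N - N) ⟩
  p * (N * N - N)                        ∎
  where
  open ≡-Reasoning
  m p P N : ℚ
  m = fromℕ (edges G)
  p = density G
  P = fromℕ (n C 2)
  N = fromℕ n
  m≡pP : m ≡ p * P
  m≡pP = ≡.sym (ratio-* (edges G) (n C 2) (edges≤nC2 G))
  double-half : ∀ p s → p * (½ * s) + p * (½ * s) ≡ p * s
  double-half = solve-∀ ℚ-ring

avgDegree≡density*[n-1] : ∀ {n} (G : Graph n) → avgDegree G ≡ density G * (fromℕ n - 1ℚ)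
avgDegree≡density*[n-1] {zero}  G = refl  -- both sides are junk values 0
avgDegree≡density*[n-1] {suc n} G = *-cancelʳ-fromℕ-suc n (begin
  avgDegree G * N                       ≡⟨ ratio-*-suc (2 ℕ.* edges G) n ⟩
  fromℕ (2 ℕ.* edges G)                 ≡⟨ fromℕ-* 2 (edges G) ⟩
  fromℕ 2 * m                           ≡⟨ two-* m ⟩
  m + m                                 ≡⟨ twice-edges≡density*[n²-n] G ⟩
  p * (N * N - N)                       ≡⟨ factor p N ⟩
  p * (N - 1ℚ) * N                      ∎)
  where
  open ≡-Reasoning
  m p N : ℚ
  m = fromℕ (edges G)
  p = density G
  N = fromℕ (suc n)
  two-* : ∀ m → fromℕ 2 * m ≡ m + m
  two-* = solve-∀ ℚ-ring
  factor : ∀ p N → p * (N * N - N) ≡ p * (N - 1ℚ) * N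
  factor = solve-∀ ℚ-ring

∑∑-Adj : ∀ {n} (G : Graph n) → ∑∑ (Adj G) ≡ fromℕ (edges G) + fromℕ (edges G)
∑∑-Adj G = trans (∑∑-hollow-symmetric (Adj G) (Adj-sym G) (Adj-irrefl G))
                 (≡.sym (cong₂ _+_ (edges≡∑< G) (edges≡∑< G)))

volume : ∀ {n} → Graph n → VSet n → ℚ
volume {n} G X = ∑[ i < n ] (χ X i * ∑[ j < n ] Adj G i j)

module _ {n} (G : Graph n) (X : VSet n) where

  ∑∑-χAdj : ∑∑ (λ i j → χ X i * Adj G i j) ≡ volume G X
  ∑∑-χAdj = sum-cong-≗ (λ i → ∑-scale (χ X i) (Adj G i))

  ∑∑-Adjχ : ∑∑ (λ i j → χ X j * Adj G i j) ≡ volume G X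
  ∑∑-Adjχ = trans (∑∑-transpose (λ i j → χ X i * Adj G j i))
                  (trans (∑∑-cong (λ i j → cong (χ X i *_) (Adj-sym G j i))) ∑∑-χAdj)

  ∑∑-χχAdj : ∑∑ (λ i j → χ X i * χ X j * Adj G i j) ≡ fromℕ (eIn G X) + fromℕ (eIn G X)
  ∑∑-χχAdj = trans (∑∑-hollow-symmetric _ χχAdj-sym χχAdj-hollow) (≡.sym (cong₂ _+_ (eIn≡∑< G X) (eIn≡∑< G X)))
    where
    χχAdj-sym : ∀ i j → χ X i * χ X j * Adj G i j ≡ χ X j * χ X i * Adj G j i
    χχAdj-sym i j = cong₂ _*_ (*-comm (χ X i) (χ X j)) (Adj-sym G i j)
    χχAdj-hollow : ∀ i → χ X i * χ X i * Adj G i i ≡ 0ℚ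
    χχAdj-hollow i = trans (cong (χ X i * χ X i *_) (Adj-irrefl G i)) (*-zeroʳ (χ X i * χ X i))

  volume≡2eIn+eBetween : volume G X ≡ fromℕ (eIn G X) + fromℕ (eIn G X) + fromℕ (eBetween G X (complement X))
  volume≡2eIn+eBetween = begin
    volume G X                                         ≡⟨ ∑∑-χAdj ⟨
    ∑∑ (λ i j → χ X i * Adj G i j)                     ≡⟨ ∑∑-cong split ⟩
    ∑∑ (λ i j → χ X i * χ X j * Adj G i j + χ X i * (χ (complement X) j * Adj G i j))
      ≡⟨ ∑∑-distrib-+ (λ i j → χ X i * χ X j * Adj G i j) (λ i j → χ X i * (χ (complement X) j * Adj G i j)) ⟩
    ∑∑ (λ i j → χ X i * χ X j * Adj G i j) + ∑∑ (λ i j → χ X i * (χ (complement X) j * Adj G i j))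
      ≡⟨ cong₂ _+_ ∑∑-χχAdj (≡.sym (eBetween≡∑∑ G X (complement X))) ⟩
    fromℕ (eIn G X) + fromℕ (eIn G X) + fromℕ (eBetween G X (complement X)) ∎
    where
    open ≡-Reasoning
    χ+χᶜ≡1 : ∀ j → χ X j + χ (complement X) j ≡ 1ℚ
    χ+χᶜ≡1 j rewrite lookup-map j not X with lookup X j
    ... | true  = refl
    ... | false = refl
    split : ∀ i j → χ X i * Adj G i j ≡ χ X i * χ X j * Adj G i j + χ X i * (χ (complement X) j * Adj G i j)
    split i j = begin
      χ X i * Adj G i j                                 ≡⟨ cong (χ X i *_) (*-identityˡ (Adj G i j)) ⟨
      χ X i * (1ℚ * Adj G i j)                          ≡⟨ cong (λ s → χ X i * (s * Adj G i j)) (χ+χᶜ≡1 j) ⟨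
      χ X i * ((χ X j + χ (complement X) j) * Adj G i j)  ≡⟨ distribute (χ X i) (χ X j) (χ (complement X) j) (Adj G i j) ⟩
      χ X i * χ X j * Adj G i j + χ X i * (χ (complement X) j * Adj G i j) ∎
      where
      distribute : ∀ u v w a → u * ((v + w) * a) ≡ u * v * a + u * (w * a)
      distribute = solve-∀ ℚ-ring

  volume-≥ : ∀ c → (∀ v → lookup X v ≡ true → c ≤ fromℕ (degree G v)) → c * ∑[ i < n ] χ X i ≤ volume G X
  volume-≥ c deg-≥ = begin
    c * ∑[ i < n ] χ X i               ≡⟨ ∑-scale c (χ X) ⟨
    ∑[ i < n ] (c * χ X i)              ≤⟨ ∑-mono-≤ term-≤ ⟩
    volume G X                          ∎
    where
    open ≤-Reasoning
    term-≤ : ∀ i → c * χ X i ≤ χ X i * ∑[ j < n ] Adj G i j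
    term-≤ i with lookup X i in Xi
    ... | true  = subst₂ _≤_ (≡.sym (*-identityʳ c))
                             (trans (degree≡∑ G i) (≡.sym (*-identityˡ (∑[ j < n ] Adj G i j)))) (deg-≥ i Xi)
    ... | false = ≤-reflexive (trans (*-zeroʳ c) (≡.sym (*-zeroˡ (∑[ j < n ] Adj G i j))))

module _ {n} (G : Graph n) (X : VSet n) (t : ℚ) where

  biased : Fin n → ℚ
  biased i = ½ + t * χ X i

  private
    b u : Fin n → ℚ
    b = biased
    u = χ X
    A : Fin n → Fin n → ℚ
    A = Adj G
    k N p e vol : ℚ
    k = ∑[ i < n ] u i
    N = fromℕ n
    p = density G
    e = fromℕ (eIn G X)
    vol = volume G X

  ∑-biased : ∑[ i < n ] b i ≡ ½ * N + t * k
  ∑-biased = trans (∑-distrib-+ (λ _ → ½) (λ i → t * u i)) (cong₂ _+_ (∑-const n ½) (∑-scale t u))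

  ∑-biased² : ∑[ i < n ] (b i * b i) ≡ ½ * ½ * N + (t + t * t) * k
  ∑-biased² = begin
    ∑[ i < n ] (b i * b i)                             ≡⟨ sum-cong-≗ square ⟩
    ∑[ i < n ] (½ * ½ + (t + t * t) * u i)             ≡⟨ ∑-distrib-+ (λ _ → ½ * ½) (λ i → (t + t * t) * u i) ⟩
    ∑[ i < n ] (½ * ½) + ∑[ i < n ] ((t + t * t) * u i) ≡⟨ cong₂ _+_ (∑-const n (½ * ½)) (∑-scale (t + t * t) u) ⟩
    ½ * ½ * N + (t + t * t) * k                        ∎
    where
    open ≡-Reasoning
    expand : ∀ t c → (½ + t * c) * (½ + t * c) ≡ ½ * ½ + (t * c + t * t * (c * c))
    expand = solve-∀ ℚ-ring
    collect : ∀ t c → ½ * ½ + (t * c + t * t * c) ≡ ½ * ½ + (t + t * t) * c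
    collect = solve-∀ ℚ-ring
    square : ∀ i → b i * b i ≡ ½ * ½ + (t + t * t) * u i
    square i = trans (expand t (u i))
      (trans (cong (λ c → ½ * ½ + (t * u i + t * t * c)) (𝟙-idem (lookup X i))) (collect t (u i)))

  ∑∑-biased-Adj : ∑∑ (λ i j → b i * b j * A i j) ≡
    ½ * ½ * (p * (N * N - N)) + (½ * t * vol + (½ * t * vol + t * t * (e + e)))
  ∑∑-biased-Adj = begin
    ∑∑ (λ i j → b i * b j * A i j)
      ≡⟨ ∑∑-cong (λ i j → expand t (u i) (u j) (A i j)) ⟩
    ∑∑ (λ i j → ½ * ½ * A i j + (½ * t * (u i * A i j) + (½ * t * (u j * A i j) + t * t * (u i * u j * A i j))))
      ≡⟨ ∑∑-+-scale (½ * ½) A _ ⟩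
    ½ * ½ * ∑∑ A + ∑∑ (λ i j → ½ * t * (u i * A i j) + (½ * t * (u j * A i j) + t * t * (u i * u j * A i j)))
      ≡⟨ cong (½ * ½ * ∑∑ A +_) (∑∑-+-scale (½ * t) (λ i j → u i * A i j) _) ⟩
    ½ * ½ * ∑∑ A + (½ * t * ∑∑ (λ i j → u i * A i j)
                     + ∑∑ (λ i j → ½ * t * (u j * A i j) + t * t * (u i * u j * A i j)))
      ≡⟨ cong (λ s → ½ * ½ * ∑∑ A + (½ * t * ∑∑ (λ i j → u i * A i j) + s))
              (trans (∑∑-+-scale (½ * t) (λ i j → u j * A i j) _)
                     (cong (½ * t * ∑∑ (λ i j → u j * A i j) +_) (∑∑-scale (t * t) (λ i j → u i * u j * A i j)))) ⟩
    ½ * ½ * ∑∑ A + (½ * t * ∑∑ (λ i j → u i * A i j)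
                     + (½ * t * ∑∑ (λ i j → u j * A i j) + t * t * ∑∑ (λ i j → u i * u j * A i j)))
      ≡⟨ cong₂ (λ a r → ½ * ½ * a + r) (trans (∑∑-Adj G) (twice-edges≡density*[n²-n] G))
          (cong₂ (λ v r → ½ * t * v + r) (∑∑-χAdj G X)
            (cong₂ (λ v s → ½ * t * v + t * t * s) (∑∑-Adjχ G X) (∑∑-χχAdj G X))) ⟩
    ½ * ½ * (p * (N * N - N)) + (½ * t * vol + (½ * t * vol + t * t * (e + e))) ∎
    where
    open ≡-Reasoning
    expand : ∀ t u v a →
      (½ + t * u) * (½ + t * v) * a ≡ ½ * ½ * a + (½ * t * (u * a) + (½ * t * (v * a) + t * t * (u * v * a)))
    expand = solve-∀ ℚ-ring

  quadForm-biased : quadForm (discWeight G) b ≡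
    ½ * (t * vol + t * t * (e + e) - t * (p * k * (N - 1ℚ)) - t * t * (p * k * (k - 1ℚ)))
  quadForm-biased = begin
    quadForm w b
      ≡⟨ quadForm-symmetric w b (λ i j → cong (_- p) (Adj-sym G i j)) ⟩
    ½ * (∑∑ (λ i j → b i * b j * w i j) - ∑[ i < n ] (b i * b i * w i i))
      ≡⟨ cong₂ (λ s d → ½ * (s - d)) off-diagonal diagonal ⟩
    ½ * ((½ * ½ * (p * (N * N - N)) + (½ * t * vol + (½ * t * vol + t * t * (e + e)))
           - p * ((½ * N + t * k) * (½ * N + t * k)))
         - - p * (½ * ½ * N + (t + t * t) * k))
      ≡⟨ simplify p N k t vol e ⟩
    ½ * (t * vol + t * t * (e + e) - t * (p * k * (N - 1ℚ)) - t * t * (p * k * (k - 1ℚ))) ∎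
    where
    open ≡-Reasoning
    w : Fin n → Fin n → ℚ
    w = discWeight G
    off-diagonal : ∑∑ (λ i j → b i * b j * w i j) ≡
      ½ * ½ * (p * (N * N - N)) + (½ * t * vol + (½ * t * vol + t * t * (e + e))) - p * ((½ * N + t * k) * (½ * N + t * k))
    off-diagonal = begin
      ∑∑ (λ i j → b i * b j * w i j)               ≡⟨ ∑∑-cong (λ i j → split (b i * b j) (A i j) p) ⟩
      ∑∑ (λ i j → b i * b j * A i j - p * (b i * b j))
        ≡⟨ ∑∑-sub-scale p (λ i j → b i * b j * A i j) (λ i j → b i * b j) ⟩
      ∑∑ (λ i j → b i * b j * A i j) - p * ∑∑ (λ i j → b i * b j)
        ≡⟨ cong₂ (λ s r → s - p * r) ∑∑-biased-Adj (trans (∑∑-product b b) (cong₂ _*_ ∑-biased ∑-biased)) ⟩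
      ½ * ½ * (p * (N * N - N)) + (½ * t * vol + (½ * t * vol + t * t * (e + e))) - p * ((½ * N + t * k) * (½ * N + t * k)) ∎
      where
      split : ∀ s a p → s * (a - p) ≡ s * a - p * s
      split = solve-∀ ℚ-ring
    diagonal : ∑[ i < n ] (b i * b i * w i i) ≡ - p * (½ * ½ * N + (t + t * t) * k)
    diagonal = begin
      ∑[ i < n ] (b i * b i * w i i)          ≡⟨ sum-cong-≗ (λ i → cong (λ a → b i * b i * (a - p)) (Adj-irrefl G i)) ⟩
      ∑[ i < n ] (b i * b i * (0ℚ - p))       ≡⟨ sum-cong-≗ (λ i → rearrange (b i * b i) p) ⟩
      ∑[ i < n ] (- p * (b i * b i))          ≡⟨ ∑-scale (- p) (λ i → b i * b i) ⟩
      - p * ∑[ i < n ] (b i * b i)            ≡⟨ cong (- p *_) ∑-biased² ⟩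
      - p * (½ * ½ * N + (t + t * t) * k)     ∎
      where
      rearrange : ∀ s p → s * (0ℚ - p) ≡ - p * s
      rearrange = solve-∀ ℚ-ring
    simplify : ∀ p N k t v e →
      ½ * ((½ * ½ * (p * (N * N - N)) + (½ * t * v + (½ * t * v + t * t * (e + e))) - p * ((½ * N + t * k) * (½ * N + t * k)))
            - - p * (½ * ½ * N + (t + t * t) * k))
      ≡ ½ * (t * v + t * t * (e + e) - t * (p * k * (N - 1ℚ)) - t * t * (p * k * (k - 1ℚ)))
    simplify = solve-∀ ℚ-ring

biased-∈-unit-interval : ∀ {δ} → 0ℚ ≤ δ → δ ≤ 1ℚ → ∀ c →
  0ℚ ≤ ½ + ½ * δ * 𝟙 c × ½ + ½ * δ * 𝟙 c ≤ 1ℚ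
biased-∈-unit-interval {δ} 0≤δ δ≤1 c =
  +-nonNeg (nonNegative⁻¹ ½) (*-nonNeg (*-nonNeg (nonNegative⁻¹ ½) 0≤δ) (0≤𝟙 c)) ,
  0≤q-p⇒p≤q (subst (0ℚ ≤_) (slack δ (𝟙 c)) (+-nonNeg (*-nonNeg (nonNegative⁻¹ ½) (p≤q⇒0≤q-p δ≤1))
                                             (*-nonNeg (*-nonNeg (nonNegative⁻¹ ½) 0≤δ) (p≤q⇒0≤q-p (𝟙≤1 c)))))
  where
  slack : ∀ δ c → ½ * (1ℚ - δ) + ½ * δ * (1ℚ - c) ≡ 1ℚ - (½ + ½ * δ * c)
  slack = solve-∀ ℚ-ring

1/16 : ℚ
1/16 = ℤ.+ 1 / 16

-- In the application e = e(X), b = e(X,Xᶜ), D = p|X|(n−1) = d|X| and E = p|X|(|X|−1).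
biased-gain : ∀ {δ e b D E} →
  0ℚ ≤ δ → δ ≤ 1ℚ → 0ℚ ≤ e → 0ℚ ≤ D → E ≤ D → (1ℚ + δ) * D ≤ e + e + b →
  δ * δ * 1/16 * (e + b) ≤ ½ * (½ * δ * (e + e + b) + ½ * δ * (½ * δ) * (e + e) - ½ * δ * D - ½ * δ * (½ * δ) * E)
biased-gain {δ} {e} {b} {D} {E} 0≤δ δ≤1 0≤e 0≤D E≤D [1+δ]D≤2e+b =
  0≤q-p⇒p≤q (subst (0ℚ ≤_) (certificate δ e b D E) (*-nonNeg (0≤1/16) (
    +-nonNeg (+-nonNeg (+-nonNeg (*-nonNeg (*-nonNeg 0≤δ 0≤4-δ) (p≤q⇒0≤q-p [1+δ]D≤2e+b))
                   (*-nonNeg (*-nonNeg δ² (p≤q⇒0≤q-p δ≤1)) 0≤D))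
             (*-nonNeg (*-nonNeg (fromℕ-nonNeg 2) δ²) (p≤q⇒0≤q-p E≤D)))
        (*-nonNeg (*-nonNeg (fromℕ-nonNeg 5) δ²) 0≤e))))
  where
  0≤1/16 : 0ℚ ≤ 1/16
  0≤1/16 = nonNegative⁻¹ 1/16
  δ² : 0ℚ ≤ δ * δ
  δ² = *-nonNeg 0≤δ 0≤δ
  0≤4-δ : 0ℚ ≤ fromℕ 4 - δ
  0≤4-δ = p≤q⇒0≤q-p (≤-trans δ≤1 (fromℕ-mono-≤ {1} {4} (ℕ.s≤s ℕ.z≤n)))
  certificate : ∀ δ e b D E →
    1/16 * ((δ * (fromℕ 4 - δ)) * (e + e + b - (1ℚ + δ) * D) + δ * δ * (1ℚ - δ) * D
            + fromℕ 2 * (δ * δ) * (D - E) + fromℕ 5 * (δ * δ) * e)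
    ≡ ½ * (½ * δ * (e + e + b) + ½ * δ * (½ * δ) * (e + e) - ½ * δ * D - ½ * δ * (½ * δ) * E) - δ * δ * 1/16 * (e + b)
  certificate = solve-∀ ℚ-ring

module _ {n} (G : Graph n) (X : VSet n) where

  private
    k N p d : ℚ
    k = ∑[ i < n ] χ X i
    N = fromℕ n
    p = density G
    d = avgDegree G

  0≤∑χ : 0ℚ ≤ k
  0≤∑χ = subst (0ℚ ≤_) (size≡∑ X) (fromℕ-nonNeg (size X))

  ∑χ≤n : k ≤ N
  ∑χ≤n = subst (k ≤_) (trans (∑-const n 1ℚ) (*-identityˡ N)) (∑-mono-≤ (𝟙≤1 ∘ lookup X))

  density*∑χ*[n-1]≡avgDegree*∑χ : p * k * (N - 1ℚ) ≡ d * k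
  density*∑χ*[n-1]≡avgDegree*∑χ = begin
    p * k * (N - 1ℚ)     ≡⟨ swap p k (N - 1ℚ) ⟩
    p * (N - 1ℚ) * k     ≡⟨ cong (_* k) (avgDegree≡density*[n-1] G) ⟨
    d * k                ∎
    where
    open ≡-Reasoning
    swap : ∀ a b c → a * b * c ≡ a * c * b
    swap = solve-∀ ℚ-ring

  quadForm-biased-≥ : ∀ {δ} → 0ℚ ≤ δ → δ ≤ 1ℚ →
    (∀ v → lookup X v ≡ true → (1ℚ + δ) * d ≤ fromℕ (degree G v)) →
    δ * δ * 1/16 * (fromℕ (eIn G X) + fromℕ (eBetween G X (complement X))) ≤ quadForm (discWeight G) (biased G X (½ * δ))
  quadForm-biased-≥ {δ} 0≤δ δ≤1 deg-≥ = begin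
    δ * δ * 1/16 * (e + b)
      ≤⟨ biased-gain 0≤δ δ≤1 (fromℕ-nonNeg (eIn G X)) 0≤D E≤D [1+δ]D≤2e+b ⟩
    ½ * (½ * δ * (e + e + b) + ½ * δ * (½ * δ) * (e + e) - ½ * δ * D - ½ * δ * (½ * δ) * E)
      ≡⟨ cong (λ v → ½ * (½ * δ * v + ½ * δ * (½ * δ) * (e + e) - ½ * δ * D - ½ * δ * (½ * δ) * E))
              (volume≡2eIn+eBetween G X) ⟨
    ½ * (½ * δ * volume G X + ½ * δ * (½ * δ) * (e + e) - ½ * δ * D - ½ * δ * (½ * δ) * E)
      ≡⟨ quadForm-biased G X (½ * δ) ⟨
    quadForm (discWeight G) (biased G X (½ * δ)) ∎
    where
    open ≤-Reasoning
    e b D E : ℚ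
    e = fromℕ (eIn G X)
    b = fromℕ (eBetween G X (complement X))
    D = p * k * (N - 1ℚ)
    E = p * k * (k - 1ℚ)
    0≤D : 0ℚ ≤ D
    0≤D = subst (0ℚ ≤_) (≡.sym density*∑χ*[n-1]≡avgDegree*∑χ) (*-nonNeg (ratio-nonNeg (2 ℕ.* edges G) n) 0≤∑χ)
    E≤D : E ≤ D
    E≤D = *-monoˡ-≤-nonNeg (p * k) {{nonNegative (*-nonNeg (ratio-nonNeg (edges G) (n C 2)) 0≤∑χ)}}
                           (+-monoˡ-≤ (- 1ℚ) ∑χ≤n)
    [1+δ]D≤2e+b : (1ℚ + δ) * D ≤ e + e + b
    [1+δ]D≤2e+b = subst₂ _≤_
      (trans (*-assoc (1ℚ + δ) d k) (cong ((1ℚ + δ) *_) (≡.sym density*∑χ*[n-1]≡avgDegree*∑χ)))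
      (volume≡2eIn+eBetween G X)
      (volume-≥ G X ((1ℚ + δ) * d) deg-≥)

discPlus-≥ : ∀ {n δ} (G : Graph n) (X : VSet n) → 0ℚ ≤ δ → δ ≤ 1ℚ →
  (∀ v → lookup X v ≡ true → (1ℚ + δ) * avgDegree G ≤ fromℕ (degree G v)) →
  δ * δ * 1/16 * (fromℕ (eIn G X) + fromℕ (eBetween G X (complement X))) ≤ discPlus G
discPlus-≥ {n} {δ} G X 0≤δ δ≤1 deg-≥ = begin
  δ * δ * 1/16 * (fromℕ (eIn G X) + fromℕ (eBetween G X (complement X)))
    ≤⟨ quadForm-biased-≥ G X 0≤δ δ≤1 deg-≥ ⟩
  quadForm w x                         ≡⟨ quadForm-cong w (lookup∘tabulate x) ⟨
  quadForm w (lookup (Vec.tabulate x)) ≤⟨ proj₂ rounded ⟩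
  quadForm w (lookup (Vec.map 𝟙 U))    ≡⟨ quadForm-cong w (λ i → lookup-map i 𝟙 U) ⟩
  quadForm w (χ U)                     ≡⟨ disc≡quadForm G U ⟨
  disc G U                             ≤⟨ disc≤discPlus G U ⟩
  discPlus G                           ∎
  where
  open ≤-Reasoning
  w : Fin n → Fin n → ℚ
  w = discWeight G
  x : Fin n → ℚ
  x = biased G X (½ * δ)
  rounded : ∃ λ U → quadForm w (lookup (Vec.tabulate x)) ≤ quadForm w (lookup (Vec.map 𝟙 U))
  rounded = multiaffine-rounding (quadForm w ∘ lookup) (quadForm-multiaffine w) (Vec.tabulate x)
    (λ i → subst (λ a → 0ℚ ≤ a × a ≤ 1ℚ) (≡.sym (lookup∘tabulate x i))
                 (biased-∈-unit-interval 0≤δ δ≤1 (lookup X i)))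
  U : VSet n
  U = proj₁ rounded

lemma2p4 : (δ : ℚ) → 0ℚ < δ → δ < 1ℚ →
    Σ ℚ (λ c₁ → Σ ℚ (λ c₂ → (0ℚ < c₁) × (0ℚ < c₂) ×
      ((n : ℕ) (G : Graph n) (X : VSet n) →
        ((v : Fin n) → lookup X v ≡ true → (1ℚ + δ) * avgDegree G ≤ fromℕ (degree G v)) →
        c₁ * fromℕ (eIn G X +ℕ eBetween G X (complement X)) - c₂ * fromℕ n ≤ discPlus G)))
lemma2p4 δ 0<δ δ<1 = δ * δ * 1/16 , 1ℚ , 0<c₁ , positive⁻¹ 1ℚ , λ n G X deg-≥ → begin
  δ * δ * 1/16 * fromℕ (eIn G X +ℕ eBetween G X (complement X)) - 1ℚ * fromℕ n
    ≤⟨ p-q≤p _ (*-nonNeg (nonNegative⁻¹ 1ℚ) (fromℕ-nonNeg n)) ⟩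
  δ * δ * 1/16 * fromℕ (eIn G X +ℕ eBetween G X (complement X))
    ≡⟨ cong (δ * δ * 1/16 *_) (fromℕ-+ (eIn G X) (eBetween G X (complement X))) ⟩
  δ * δ * 1/16 * (fromℕ (eIn G X) + fromℕ (eBetween G X (complement X)))
    ≤⟨ discPlus-≥ G X (<⇒≤ 0<δ) (<⇒≤ δ<1) deg-≥ ⟩
  discPlus G ∎
  where
  open ≤-Reasoning
  0<c₁ : 0ℚ < δ * δ * 1/16
  0<c₁ = positive⁻¹ _ {{pos*pos⇒pos (δ * δ) {{pos*pos⇒pos δ {{positive 0<δ}} δ {{positive 0<δ}}}} 1/16}}
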